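{- Let $\mathbf{A}$ be a Heyting algebra with a nontrivial node $a$. Then for every $b\in\mathbf{A}$ with $b<a$ we have $b\ll a$, i.e. $a\to b=b$.
   Context: Heyting algebras are algebras $(A;\land,\lor,\to,\neg)$ with $(A;\land,\lor)$ a bounded distributive lattice and $\to$ the relative pseudocomplement. An element is a node if it is comparable with every element of the algebra; a node is nontrivial if it differs from $\mathbf{0}$ and $\mathbf{1}$. For $a,b$, $b\ll a$ means $b\leq a$ and $a\to b=b$. -}

module Defs where

open import Level using (Level)
open import Data.Sum using (_⊎_)
open import Data.Product using (_×_)
open import Relation.Nullary using (¬_)
open import Relation.Binary.Lattice.Bundles using (HeytingAlgebra)

module _ {c ℓ₁ ℓ₂ : Level} (H : HeytingAlgebra c ℓ₁ ℓ₂) where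
  open HeytingAlgebra H

  IsNode : Carrier → Set _
  IsNode a = ∀ x → (x ≤ a) ⊎ (a ≤ x)

  IsNontrivialNode : Carrier → Set _
  IsNontrivialNode a = IsNode a × (¬ (a ≈ ⊥)) × (¬ (a ≈ ⊤))

  _<_ : Carrier → Carrier → Set _
  b < a = (b ≤ a) × (¬ (b ≈ a))

  _≪_ : Carrier → Carrier → Set _
  b ≪ a = (b ≤ a) × ((a ⇨ b) ≈ b)

{-# OPTIONS --safe #-}
module Submission where

open import Defs
open import Level using (Level)
open import Relation.Binary.Lattice.Bundles using (HeytingAlgebra)
open import Data.Sum using (inj₁; inj₂)
open import Data.Product using (_,_)
open import Relation.Nullary using (contradiction)
import Relation.Binary.Lattice.Properties.HeytingAlgebra as HeytingAlgebraProperties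

-- Since a is a node, a ⇨ b lies either below a, and then a ⇨ b ≤ (a ⇨ b) ∧ a ≤ b,
-- or above a, and then a ≤ a ∧ (a ⇨ b) ≤ b, contradicting b < a.

module _ {c ℓ₁ ℓ₂ : Level} (H : HeytingAlgebra c ℓ₁ ℓ₂) where
  open HeytingAlgebra H
  open HeytingAlgebraProperties H using (y≤x⇨y; ⇨-applyˡ)

  x⇨y≤x⇒x⇨y≈y : ∀ {x y} → x ⇨ y ≤ x → x ⇨ y ≈ y
  x⇨y≤x⇒x⇨y≈y x⇨y≤x = antisym (trans (∧-greatest refl refl) (⇨-applyˡ x⇨y≤x)) y≤x⇨y

  x≤x⇨y⇒x≤y : ∀ {x y} → x ≤ x ⇨ y → x ≤ y
  x≤x⇨y⇒x≤y x≤x⇨y = trans (∧-greatest refl refl) (transpose-∧ x≤x⇨y)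

  node⇒<⇒≪ : ∀ {a b} → IsNode H a → _<_ H b a → _≪_ H b a
  node⇒<⇒≪ {a} {b} node (b≤a , b≉a) with node (a ⇨ b)
  ... | inj₁ a⇨b≤a = b≤a , x⇨y≤x⇒x⇨y≈y a⇨b≤a
  ... | inj₂ a≤a⇨b = contradiction (antisym b≤a (x≤x⇨y⇒x≤y a≤a⇨b)) b≉a

proposition6 : {c ℓ₁ ℓ₂ : Level} (H : HeytingAlgebra c ℓ₁ ℓ₂) (a : HeytingAlgebra.Carrier H) →
    IsNontrivialNode H a →
    (b : HeytingAlgebra.Carrier H) → _<_ H b a → _≪_ H b a
proposition6 H a (node , _) b = node⇒<⇒≪ H node
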